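{- Let $t,k$ be positive integers with $k\le t/6$, and let $F$ be a $[t,k]$-interval system. Then there exists a randomized $[t,k]$-interval system $\mathcal F$ such that: (1) $\mathrm{Sets}(\mathcal F)=\mathrm{Sets}(F)$; (2) $\mathrm{val}(\mathcal F)\le 5\,\mathrm{val}(F)$; (3) $\mathcal F$ is valid.
   Context: An interval is a nonempty set $\{a,\dots,b\}$ of integers; a $[t,k]$-interval system is a set of $k$ pairwise disjoint intervals in $[t]$; a randomized $[t,k]$-interval system is a distribution over them. $\mathrm{Sets}(F)$ is the distribution of the set obtained by choosing independently a uniform element from each interval of $F$; for randomized $\mathcal F$, sample $F\sim\mathcal F$ then a set from $\mathrm{Sets}(F)$. $\mathrm{val}(F)=\sum_{I\in F}1/|I|$ and $\mathrm{val}(\mathcal F)=\mathbb E_{F\sim\mathcal F}\mathrm{val}(F)$. An interval system $F$ is valid if $\sum_{I\in F}|I|\le t/2$; a randomized system is valid if every system in its support is valid. -}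

module Defs where

open import Data.Nat as ℕ using (ℕ; zero; suc; _+_; _∸_)
open import Data.Integer using (+_)
open import Data.Rational as ℚ using (ℚ; 0ℚ; 1ℚ)
open import Data.Bool using (Bool)
import Data.Bool as Bool
open import Data.Fin using (Fin; toℕ)
open import Data.Fin.Subset using (Subset)
open import Data.Vec using (tabulate)
open import Data.Vec.Properties using (≡-dec)
open import Data.List using (List; []; _∷_; [_]; map; concatMap; upTo; length; filter; foldr)
open import Data.Bool.ListAction using (any)
open import Data.List.Relation.Unary.All using (All)
open import Data.List.Relation.Unary.AllPairs using (AllPairs)
open import Data.Product using (_×_; proj₁; proj₂)
open import Relation.Nullary using (¬_; does)
open import Relation.Binary.PropositionalEquality using (_≡_)

record Interval (t : ℕ) : Set where
  constructor interval
  field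
    lo hi : ℕ
    1≤lo  : 1 ℕ.≤ lo
    lo≤hi : lo ℕ.≤ hi
    hi≤t  : hi ℕ.≤ t
open Interval public

_∈ᴵ_ : ∀ {t} → ℕ → Interval t → Set
x ∈ᴵ I = lo I ℕ.≤ x × x ℕ.≤ hi I

size : ∀ {t} → Interval t → ℕ
size I = suc (hi I ∸ lo I)

elements : ∀ {t} → Interval t → List ℕ
elements I = map (λ j → lo I + j) (upTo (size I))

Disjoint : ∀ {t} → Interval t → Interval t → Set
Disjoint I J = ∀ x → ¬ (x ∈ᴵ I × x ∈ᴵ J)

record IntervalSystem (t k : ℕ) : Set where
  constructor system
  field
    intervals : List (Interval t)
    card      : length intervals ≡ k
    disjoint  : AllPairs Disjoint intervals
open IntervalSystem public

sumℚ : List ℚ → ℚ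
sumℚ = foldr ℚ._+_ 0ℚ

prodℚ : List ℚ → ℚ
prodℚ = foldr ℚ._*_ 1ℚ

sumℕ : List ℕ → ℕ
sumℕ = foldr _+_ 0

invSize : ∀ {t} → Interval t → ℚ
invSize I = (+ 1) ℚ./ size I

val : ∀ {t k} → IntervalSystem t k → ℚ
val F = sumℚ (map invSize (intervals F))

-- All ways of choosing one element from each interval (each equally likely
-- under Sets(F), with probability ∏ 1/|I|).
choices : ∀ {t} → List (Interval t) → List (List ℕ)
choices []       = [ [] ]
choices (I ∷ Is) = concatMap (λ x → map (λ c → x ∷ c) (choices Is)) (elements I)

-- The subset of [t] = {1..t} formed by a choice (Fin index i stands for i+1).
toSubset : ∀ {t} → List ℕ → Subset t
toSubset c = tabulate (λ i → any (λ x → does (x ℕ.≟ suc (toℕ i))) c)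

setsProb : ∀ {t k} → IntervalSystem t k → Subset t → ℚ
setsProb F S =
  ((+ length (filter (λ c → ≡-dec Bool._≟_ (toSubset c) S) (choices (intervals F)))) ℚ./ 1)
  ℚ.* prodℚ (map invSize (intervals F))

Valid : ∀ {t k} → IntervalSystem t k → Set
Valid {t} F = 2 ℕ.* sumℕ (map size (intervals F)) ℕ.≤ t

record RandSystem (t k : ℕ) : Set where
  constructor randSystem
  field
    entries : List (ℚ × IntervalSystem t k)
    nonneg  : All (λ p → 0ℚ ℚ.≤ proj₁ p) entries
    total   : sumℚ (map proj₁ entries) ≡ 1ℚ
open RandSystem public

randSetsProb : ∀ {t k} → RandSystem t k → Subset t → ℚ
randSetsProb 𝓕 S = sumℚ (map (λ p → proj₁ p ℚ.* setsProb (proj₂ p) S) (entries 𝓕))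

randVal : ∀ {t k} → RandSystem t k → ℚ
randVal 𝓕 = sumℚ (map (λ p → proj₁ p ℚ.* val (proj₂ p)) (entries 𝓕))

RandValid : ∀ {t k} → RandSystem t k → Set
RandValid 𝓕 = All (λ p → 0ℚ ℚ.< proj₁ p → Valid (proj₂ p)) (entries 𝓕)

module Submission where

-- Halve every interval I of F twice, getting at most four consecutive pieces of size at most ⌈|I|/4⌉,
-- and pick one piece of each interval independently, the piece P of I with probability |P|/|I|.
-- A uniform element of a piece picked this way is a uniform element of I, so Sets is unchanged.
-- The expected value of 1/|P| is (number of pieces)/|I| ≤ 4/|I|.  Every outcome satisfies
-- 4 Σ|P| ≤ Σ|I| + 3k ≤ t + 3k ≤ 2t, since disjoint intervals of [t] have total size at most t
-- (count, for each x ∈ [t], the intervals containing x) and 6k ≤ t.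

open import Algebra.Bundles using (CommutativeSemiring; CommutativeRing)
open import Data.List using (List; []; _∷_; [_]; map; foldr; _++_; concatMap; length; upTo; applyUpTo; downFrom; filter)
import Data.List.Properties as List
open import Function using (_∘_)
import Relation.Binary.PropositionalEquality as ≡

module ListSum {c ℓ} (R : CommutativeSemiring c ℓ) where

  open CommutativeSemiring R
  open import Relation.Binary.Reasoning.Setoid setoid
  open import Algebra.Properties.CommutativeSemigroup +-commutativeSemigroup using (interchange)

  sum : List Carrier → Carrier
  sum = foldr _+_ 0#

  module _ {a} {A : Set a} where

    sum-map-cong : {f g : A → Carrier} → (∀ x → f x ≈ g x) → ∀ xs → sum (map f xs) ≈ sum (map g xs)
    sum-map-cong f≈g []       = refl
    sum-map-cong f≈g (x ∷ xs) = +-cong (f≈g x) (sum-map-cong f≈g xs)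

    sum-map-++ : ∀ (f : A → Carrier) xs ys → sum (map f (xs ++ ys)) ≈ sum (map f xs) + sum (map f ys)
    sum-map-++ f []       ys = sym (+-identityˡ _)
    sum-map-++ f (x ∷ xs) ys = begin
      f x + sum (map f (xs ++ ys))             ≈⟨ +-congˡ (sum-map-++ f xs ys) ⟩
      f x + (sum (map f xs) + sum (map f ys))  ≈⟨ sym (+-assoc _ _ _) ⟩
      f x + sum (map f xs) + sum (map f ys)    ∎

    sum-map-+ : ∀ (f g : A → Carrier) xs → sum (map (λ x → f x + g x) xs) ≈ sum (map f xs) + sum (map g xs)
    sum-map-+ f g []       = sym (+-identityˡ 0#)
    sum-map-+ f g (x ∷ xs) = trans (+-congˡ (sum-map-+ f g xs)) (interchange _ _ _ _)

    sum-map-*ˡ : ∀ k (f : A → Carrier) xs → sum (map (λ x → k * f x) xs) ≈ k * sum (map f xs)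
    sum-map-*ˡ k f []       = sym (zeroʳ k)
    sum-map-*ˡ k f (x ∷ xs) = trans (+-congˡ (sum-map-*ˡ k f xs)) (sym (distribˡ k _ _))

    sum-map-0# : ∀ (xs : List A) → sum (map (λ _ → 0#) xs) ≈ 0#
    sum-map-0# []       = refl
    sum-map-0# (x ∷ xs) = trans (+-identityˡ _) (sum-map-0# xs)

  module _ {a b} {A : Set a} {B : Set b} where

    sum-map-∘ : ∀ (g : B → Carrier) (f : A → B) xs → sum (map g (map f xs)) ≈ sum (map (g ∘ f) xs)
    sum-map-∘ g f xs = reflexive (≡.cong sum (≡.sym (List.map-∘ xs)))

    sum-map-concatMap : ∀ (g : B → Carrier) (f : A → List B) xs →
                        sum (map g (concatMap f xs)) ≈ sum (map (λ x → sum (map g (f x))) xs)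
    sum-map-concatMap g f []       = refl
    sum-map-concatMap g f (x ∷ xs) =
      trans (sum-map-++ g (f x) (concatMap f xs)) (+-congˡ (sum-map-concatMap g f xs))

    sum-map-comm : ∀ (h : A → B → Carrier) xs ys →
                   sum (map (λ x → sum (map (h x) ys)) xs) ≈ sum (map (λ y → sum (map (λ x → h x y) xs)) ys)
    sum-map-comm h []       ys = sym (sum-map-0# ys)
    sum-map-comm h (x ∷ xs) ys = trans (+-congˡ (sum-map-comm h xs ys)) (sym (sum-map-+ (h x) _ ys))

open import Data.Bool as Bool using (true; false; if_then_else_)
open import Data.Fin.Subset using (Subset)
open import Data.Nat as ℕ
  using (ℕ; zero; suc; _+_; _*_; _∸_; _≤_; _≤′_; ≤′-refl; ≤′-step; _≤?_; z≤n; s≤s; ⌊_/2⌋; ⌈_/2⌉)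
import Data.Nat.Properties as ℕ
open import Data.Nat.Solver using () renaming (module +-*-Solver to ℕSolver)
import Data.Integer as ℤ
import Data.Integer.Properties as ℤ
open import Data.List.Relation.Unary.All as All using (All; []; _∷_)
import Data.List.Relation.Unary.All.Properties as All
open import Data.List.Relation.Unary.AllPairs using (AllPairs; []; _∷_)
open import Data.List.Relation.Binary.Pointwise as Pointwise using (Pointwise; []; _∷_; Pointwise-length)
open import Data.Product using (Σ; _×_; _,_; proj₁; proj₂)
open import Data.Rational as ℚ using (ℚ; 0ℚ; 1ℚ; toℚᵘ)
import Data.Rational.Properties as ℚ
open import Data.Rational.Solver using (module +-*-Solver)
open import Data.Rational.Unnormalised as ℚᵘ using (mkℚᵘ; *≡*; _≃_)
import Data.Rational.Unnormalised.Properties as ℚᵘ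
open import Data.Vec.Properties using (≡-dec)
open import Relation.Nullary using (Dec; yes; no; does; ¬_; _×-dec_)
open import Relation.Nullary.Decidable using (dec-true; dec-false)
open import Relation.Unary using (Decidable)
open import Relation.Binary.PropositionalEquality hiding ([_])
import Algebra.Properties.CommutativeSemigroup as CommSemigroupProperties

open import Defs

module ℕSum = ListSum ℕ.+-*-commutativeSemiring
module ℚSum = ListSum (CommutativeRing.commutativeSemiring ℚ.+-*-commutativeRing)
module ℕ+ = CommSemigroupProperties ℕ.+-commutativeSemigroup
module ℚ* = CommSemigroupProperties (CommutativeRing.*-commutativeSemigroup ℚ.+-*-commutativeRing)

fromℕ : ℕ → ℚ
fromℕ n = ℤ.+ n ℚ./ 1

private
  toℚᵘ-/ : ∀ m n → toℚᵘ (ℤ.+ m ℚ./ suc n) ≃ mkℚᵘ (ℤ.+ m) n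
  toℚᵘ-/ m n = ℚ.toℚᵘ-fromℚᵘ (mkℚᵘ (ℤ.+ m) n)

fromℕ-+ : ∀ m n → fromℕ (m + n) ≡ fromℕ m ℚ.+ fromℕ n
fromℕ-+ m n = ℚ.toℚᵘ-injective (begin
  toℚᵘ (fromℕ (m + n))                ≈⟨ toℚᵘ-/ (m + n) 0 ⟩
  mkℚᵘ (ℤ.+ (m + n)) 0                ≈⟨ *≡* (cong (ℤ._* ℤ.+ 1) (trans (ℤ.pos-+ m n) (sym (cong₂ ℤ._+_ (ℤ.*-identityʳ (ℤ.+ m))
                                                                                                     (ℤ.*-identityʳ (ℤ.+ n)))))) ⟩
  mkℚᵘ (ℤ.+ m) 0 ℚᵘ.+ mkℚᵘ (ℤ.+ n) 0  ≈⟨ ℚᵘ.≃-sym (ℚᵘ.+-cong (toℚᵘ-/ m 0) (toℚᵘ-/ n 0)) ⟩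
  toℚᵘ (fromℕ m) ℚᵘ.+ toℚᵘ (fromℕ n)  ≈⟨ ℚᵘ.≃-sym (ℚ.toℚᵘ-homo-+ (fromℕ m) (fromℕ n)) ⟩
  toℚᵘ (fromℕ m ℚ.+ fromℕ n)          ∎)
  where open ℚᵘ.≃-Reasoning

m/n≡m*1/n : ∀ m n → ℤ.+ m ℚ./ suc n ≡ fromℕ m ℚ.* (ℤ.+ 1 ℚ./ suc n)
m/n≡m*1/n m n = ℚ.toℚᵘ-injective (begin
  toℚᵘ (ℤ.+ m ℚ./ suc n)                      ≈⟨ toℚᵘ-/ m n ⟩
  mkℚᵘ (ℤ.+ m) n                              ≈⟨ *≡* (trans (cong (ℤ.+ m ℤ.*_) (ℤ.*-identityˡ (ℤ.+ suc n)))
                                                            (cong (ℤ._* ℤ.+ suc n) (sym (ℤ.*-identityʳ (ℤ.+ m))))) ⟩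
  mkℚᵘ (ℤ.+ m) 0 ℚᵘ.* mkℚᵘ (ℤ.+ 1) n          ≈⟨ ℚᵘ.≃-sym (ℚᵘ.*-cong (toℚᵘ-/ m 0) (toℚᵘ-/ 1 n)) ⟩
  toℚᵘ (fromℕ m) ℚᵘ.* toℚᵘ (ℤ.+ 1 ℚ./ suc n)  ≈⟨ ℚᵘ.≃-sym (ℚ.toℚᵘ-homo-* (fromℕ m) (ℤ.+ 1 ℚ./ suc n)) ⟩
  toℚᵘ (fromℕ m ℚ.* (ℤ.+ 1 ℚ./ suc n))        ∎)
  where open ℚᵘ.≃-Reasoning

n*1/n≡1 : ∀ n → fromℕ (suc n) ℚ.* (ℤ.+ 1 ℚ./ suc n) ≡ 1ℚ
n*1/n≡1 n = trans (sym (m/n≡m*1/n (suc n) n))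
  (ℚ.toℚᵘ-injective (ℚᵘ.≃-trans (toℚᵘ-/ (suc n) n) (*≡* (ℤ.*-comm (ℤ.+ suc n) (ℤ.+ 1)))))

0≤m/n : ∀ m n → 0ℚ ℚ.≤ ℤ.+ m ℚ./ suc n
0≤m/n m n = ℚ.nonNegative⁻¹ _ {{ℚ.normalize-nonNeg m (suc n)}}

0≤*0≤⇒0≤ : ∀ {p q} → 0ℚ ℚ.≤ p → 0ℚ ℚ.≤ q → 0ℚ ℚ.≤ p ℚ.* q
0≤*0≤⇒0≤ {p} {q} 0≤p 0≤q =
  ℚ.nonNegative⁻¹ _ {{ℚ.nonNeg*nonNeg⇒nonNeg p {{ℚ.nonNegative 0≤p}} q {{ℚ.nonNegative 0≤q}}}}

fromℕ-mono-≤ : ∀ {m n} → m ≤ n → fromℕ m ℚ.≤ fromℕ n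
fromℕ-mono-≤ {m} {n} m≤n = begin
  fromℕ m                      ≡⟨ sym (ℚ.+-identityʳ _) ⟩
  fromℕ m ℚ.+ 0ℚ               ≤⟨ ℚ.+-monoʳ-≤ (fromℕ m) (0≤m/n (n ∸ m) 0) ⟩
  fromℕ m ℚ.+ fromℕ (n ∸ m)    ≡⟨ sym (fromℕ-+ m (n ∸ m)) ⟩
  fromℕ (m + (n ∸ m))          ≡⟨ cong fromℕ (ℕ.m+[n∸m]≡n m≤n) ⟩
  fromℕ n                      ∎
  where open ℚ.≤-Reasoning

sumℚ-map-const : ∀ {A : Set} (c : ℚ) (xs : List A) → sumℚ (map (λ _ → c) xs) ≡ fromℕ (length xs) ℚ.* c
sumℚ-map-const c []       = sym (ℚ.*-zeroˡ c)
sumℚ-map-const c (x ∷ xs) = begin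
  c ℚ.+ sumℚ (map (λ _ → c) xs)      ≡⟨ cong (ℚ._+_ c) (sumℚ-map-const c xs) ⟩
  c ℚ.+ fromℕ (length xs) ℚ.* c      ≡⟨ solve 2 (λ c n → c :+ n :* c := (con 1ℚ :+ n) :* c) refl c (fromℕ (length xs)) ⟩
  (1ℚ ℚ.+ fromℕ (length xs)) ℚ.* c   ≡⟨ cong (ℚ._* c) (sym (fromℕ-+ 1 (length xs))) ⟩
  fromℕ (suc (length xs)) ℚ.* c      ∎
  where
  open ≡-Reasoning
  open +-*-Solver

sumℚ-map-mono-≤ : ∀ {A : Set} {f g : A → ℚ} → (∀ x → f x ℚ.≤ g x) → ∀ xs → sumℚ (map f xs) ℚ.≤ sumℚ (map g xs)
sumℚ-map-mono-≤ f≤g []       = ℚ.≤-refl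
sumℚ-map-mono-≤ f≤g (x ∷ xs) = ℚ.+-mono-≤ (f≤g x) (sumℚ-map-mono-≤ f≤g xs)

sumℕ-map-mono-≤ : ∀ {A : Set} {f g : A → ℕ} → (∀ x → f x ≤ g x) → ∀ xs → sumℕ (map f xs) ≤ sumℕ (map g xs)
sumℕ-map-mono-≤ f≤g []       = z≤n
sumℕ-map-mono-≤ f≤g (x ∷ xs) = ℕ.+-mono-≤ (f≤g x) (sumℕ-map-mono-≤ f≤g xs)

sumℕ-map-≤-length : ∀ {A : Set} {f : A → ℕ} → (∀ x → f x ≤ 1) → ∀ xs → sumℕ (map f xs) ≤ length xs
sumℕ-map-≤-length f≤1 []       = z≤n
sumℕ-map-≤-length f≤1 (x ∷ xs) = ℕ.+-mono-≤ (f≤1 x) (sumℕ-map-≤-length f≤1 xs)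

length-filter : ∀ {A : Set} {P : A → Set} (P? : Decidable P) xs →
                fromℕ (length (filter P? xs)) ≡ sumℚ (map (λ x → if does (P? x) then 1ℚ else 0ℚ) xs)
length-filter P? []       = refl
length-filter P? (x ∷ xs) with does (P? x)
... | true  = trans (fromℕ-+ 1 (length (filter P? xs))) (cong (ℚ._+_ 1ℚ) (length-filter P? xs))
... | false = trans (length-filter P? xs) (sym (ℚ.+-identityˡ _))

applyUpTo-+ : ∀ {A : Set} (f : ℕ → A) m n → applyUpTo f (m + n) ≡ applyUpTo f m ++ applyUpTo (f ∘ (m +_)) n
applyUpTo-+ f zero    n = refl
applyUpTo-+ f (suc m) n = cong (f 0 ∷_) (applyUpTo-+ (f ∘ suc) m n)

map-+-upTo-+ : ∀ l m n → map (l +_) (upTo (m + n)) ≡ map (l +_) (upTo m) ++ map ((l + m) +_) (upTo n)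
map-+-upTo-+ l m n = begin
  map (l +_) (upTo (m + n))                                ≡⟨ List.map-upTo (l +_) (m + n) ⟩
  applyUpTo (l +_) (m + n)                                 ≡⟨ applyUpTo-+ (l +_) m n ⟩
  applyUpTo (l +_) m ++ applyUpTo (λ x → l + (m + x)) n    ≡⟨ cong₂ _++_ (sym (List.map-upTo (l +_) m))
                                                                         (sym (List.map-upTo (λ x → l + (m + x)) n)) ⟩
  map (l +_) (upTo m) ++ map (λ x → l + (m + x)) (upTo n)  ≡⟨ cong (map (l +_) (upTo m) ++_)
                                                                   (List.map-cong (λ x → sym (ℕ.+-assoc l m x)) (upTo n)) ⟩
  map (l +_) (upTo m) ++ map ((l + m) +_) (upTo n)         ∎
  where open ≡-Reasoning

concatMap-concatMap : ∀ {A B C : Set} (g : B → List C) (f : A → List B) xs →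
                      concatMap g (concatMap f xs) ≡ concatMap (concatMap g ∘ f) xs
concatMap-concatMap g f []       = refl
concatMap-concatMap g f (x ∷ xs) =
  trans (List.concatMap-++ g (f x) (concatMap f xs)) (cong (concatMap g (f x) ++_) (concatMap-concatMap g f xs))

length-concatMap-≤ : ∀ {A B : Set} {f : A → List B} {b} → (∀ x → length (f x) ≤ b) →
                     ∀ xs → length (concatMap f xs) ≤ length xs * b
length-concatMap-≤             bound []       = z≤n
length-concatMap-≤ {f = f} {b} bound (x ∷ xs) = begin
  length (f x ++ concatMap f xs)          ≡⟨ List.length-++ (f x) ⟩
  length (f x) + length (concatMap f xs)  ≤⟨ ℕ.+-mono-≤ (bound x) (length-concatMap-≤ bound xs) ⟩
  b + length xs * b                       ∎
  where open ℕ.≤-Reasoning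

module _ {A B : Set} {P : A → Set} (f : ∀ {x} → P x → B) where

  All-reduce : ∀ {Q : B → Set} → (∀ {x} (px : P x) → Q (f px)) → ∀ {xs} (pxs : All P xs) → All Q (All.reduce f pxs)
  All-reduce q []         = []
  All-reduce q (px ∷ pxs) = q px ∷ All-reduce q pxs

  map-reduce : ∀ {C : Set} (g : B → C) (h : A → C) → (∀ {x} (px : P x) → g (f px) ≡ h x) →
               ∀ {xs} (pxs : All P xs) → map g (All.reduce f pxs) ≡ map h xs
  map-reduce g h g∘f≡h []         = refl
  map-reduce g h g∘f≡h (px ∷ pxs) = cong₂ _∷_ (g∘f≡h px) (map-reduce g h g∘f≡h pxs)

2*⌊n/2⌋≤n : ∀ n → 2 * ⌊ n /2⌋ ≤ n
2*⌊n/2⌋≤n n = begin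
  2 * ⌊ n /2⌋        ≡⟨ cong (⌊ n /2⌋ +_) (ℕ.+-identityʳ _) ⟩
  ⌊ n /2⌋ + ⌊ n /2⌋  ≤⟨ ℕ.+-monoʳ-≤ ⌊ n /2⌋ (ℕ.⌊n/2⌋≤⌈n/2⌉ n) ⟩
  ⌊ n /2⌋ + ⌈ n /2⌉  ≡⟨ ℕ.⌊n/2⌋+⌈n/2⌉≡n n ⟩
  n                  ∎
  where open ℕ.≤-Reasoning

1+n≡⌊n/2⌋+1+⌈n/2⌉ : ∀ n → suc n ≡ ⌊ n /2⌋ + suc ⌈ n /2⌉
1+n≡⌊n/2⌋+1+⌈n/2⌉ n = trans (cong suc (sym (ℕ.⌊n/2⌋+⌈n/2⌉≡n n))) (sym (ℕ.+-suc ⌊ n /2⌋ ⌈ n /2⌉))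

Weighted : Set → Set
Weighted A = List (ℚ × A)

module _ {A : Set} where

  expect : Weighted A → (A → ℚ) → ℚ
  expect d f = sumℚ (map (λ e → proj₁ e ℚ.* f (proj₂ e)) d)

  mass : Weighted A → ℚ
  mass d = sumℚ (map proj₁ d)

  Supported : (A → Set) → Weighted A → Set
  Supported P d = All (λ e → 0ℚ ℚ.≤ proj₁ e × P (proj₂ e)) d

  _⊗_ : Weighted A → Weighted (List A) → Weighted (List A)
  d ⊗ ds = concatMap (λ e → map (λ es → (proj₁ e ℚ.* proj₁ es , proj₂ e ∷ proj₂ es)) ds) d

  product : List (Weighted A) → Weighted (List A)
  product = foldr _⊗_ [ (1ℚ , []) ]

  expect-cong : ∀ d {f g : A → ℚ} → (∀ a → f a ≡ g a) → expect d f ≡ expect d g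
  expect-cong d f≡g = ℚSum.sum-map-cong (λ e → cong (proj₁ e ℚ.*_) (f≡g (proj₂ e))) d

  expect-+ : ∀ d (f g : A → ℚ) → expect d (λ a → f a ℚ.+ g a) ≡ expect d f ℚ.+ expect d g
  expect-+ d f g = trans (ℚSum.sum-map-cong (λ e → ℚ.*-distribˡ-+ (proj₁ e) _ _) d) (ℚSum.sum-map-+ _ _ d)

  expect-*ˡ : ∀ d c (f : A → ℚ) → expect d (λ a → c ℚ.* f a) ≡ c ℚ.* expect d f
  expect-*ˡ d c f = trans (ℚSum.sum-map-cong (λ e → ℚ*.x∙yz≈y∙xz (proj₁ e) c _) d) (ℚSum.sum-map-*ˡ c _ d)

  expect-const : ∀ d c → expect d (λ (_ : A) → c) ≡ mass d ℚ.* c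
  expect-const d c = trans (ℚSum.sum-map-cong (λ e → ℚ.*-comm (proj₁ e) c) d)
                           (trans (ℚSum.sum-map-*ˡ c proj₁ d) (ℚ.*-comm c (mass d)))

  expect-1 : ∀ d → expect d (λ (_ : A) → 1ℚ) ≡ mass d
  expect-1 d = trans (expect-const d 1ℚ) (ℚ.*-identityʳ (mass d))

  mass≡1⇒expect-const : ∀ d → mass d ≡ 1ℚ → ∀ c → expect d (λ (_ : A) → c) ≡ c
  mass≡1⇒expect-const d mass≡1 c = trans (expect-const d c) (trans (cong (ℚ._* c) mass≡1) (ℚ.*-identityˡ c))

module _ {A B : Set} where

  expect-comm : ∀ (d : Weighted A) (d′ : Weighted B) (h : A → B → ℚ) →
                expect d (λ a → expect d′ (h a)) ≡ expect d′ (λ b → expect d (λ a → h a b))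
  expect-comm d d′ h = begin
    sumℚ (map (λ e → proj₁ e ℚ.* expect d′ (h (proj₂ e))) d)
      ≡⟨ ℚSum.sum-map-cong (λ e → sym (expect-*ˡ d′ (proj₁ e) (h (proj₂ e)))) d ⟩
    sumℚ (map (λ e → sumℚ (map (λ e′ → proj₁ e′ ℚ.* (proj₁ e ℚ.* h (proj₂ e) (proj₂ e′))) d′)) d)
      ≡⟨ ℚSum.sum-map-comm (λ e e′ → proj₁ e′ ℚ.* (proj₁ e ℚ.* h (proj₂ e) (proj₂ e′))) d d′ ⟩
    sumℚ (map (λ e′ → sumℚ (map (λ e → proj₁ e′ ℚ.* (proj₁ e ℚ.* h (proj₂ e) (proj₂ e′))) d)) d′)
      ≡⟨ ℚSum.sum-map-cong (λ e′ → ℚSum.sum-map-*ˡ (proj₁ e′) _ d) d′ ⟩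
    sumℚ (map (λ e′ → proj₁ e′ ℚ.* expect d (λ a → h a (proj₂ e′))) d′) ∎
    where open ≡-Reasoning

module _ {A : Set} where

  expect-⊗ : ∀ d ds (f : List A → ℚ) → expect (d ⊗ ds) f ≡ expect d (λ a → expect ds (λ as → f (a ∷ as)))
  expect-⊗ d ds f = begin
    expect (d ⊗ ds) f
      ≡⟨ ℚSum.sum-map-concatMap _ (λ e → map (extend e) ds) d ⟩
    sumℚ (map (λ e → sumℚ (map (λ es → proj₁ es ℚ.* f (proj₂ es)) (map (extend e) ds))) d)
      ≡⟨ ℚSum.sum-map-cong (λ e → ℚSum.sum-map-∘ _ (extend e) ds) d ⟩
    sumℚ (map (λ e → sumℚ (map (λ es → (proj₁ e ℚ.* proj₁ es) ℚ.* f (proj₂ e ∷ proj₂ es)) ds)) d)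
      ≡⟨ ℚSum.sum-map-cong (λ e → trans (ℚSum.sum-map-cong (λ es → ℚ.*-assoc (proj₁ e) _ _) ds)
                                          (ℚSum.sum-map-*ˡ (proj₁ e) _ ds)) d ⟩
    expect d (λ a → expect ds (λ as → f (a ∷ as))) ∎
    where
    open ≡-Reasoning
    extend : ℚ × A → ℚ × List A → ℚ × List A
    extend e es = (proj₁ e ℚ.* proj₁ es , proj₂ e ∷ proj₂ es)

  ⊗-supported : ∀ {P : A → Set} {Q S : List A → Set} → (∀ {a as} → P a → Q as → S (a ∷ as)) →
                ∀ {d ds} → Supported P d → Supported Q ds → Supported S (d ⊗ ds)
  ⊗-supported _∷ˢ_ sup sups = All.concat⁺ (All.map⁺ (All.map (λ (0≤p , pa) →
    All.map⁺ (All.map (λ (0≤q , qas) → 0≤*0≤⇒0≤ 0≤p 0≤q , pa ∷ˢ qas) sups)) sup))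

  product-supported : ∀ {B : Set} (R : A → B → Set) (f : B → Weighted A) bs →
                      All (λ b → Supported (λ a → R a b) (f b)) bs →
                      Supported (λ as → Pointwise R as bs) (product (map f bs))
  product-supported R f []       []         = (0≤m/n 1 0 , []) ∷ []
  product-supported R f (b ∷ bs) (s ∷ sups) = ⊗-supported _∷_ s (product-supported R f bs sups)

  mass-product : ∀ ds → All (λ d → mass d ≡ 1ℚ) ds → mass (product ds) ≡ 1ℚ
  mass-product []       []              = ℚ.+-identityʳ 1ℚ
  mass-product (d ∷ ds) (mass≡1 ∷ masses≡1) = begin
    mass (d ⊗ product ds)                            ≡⟨ sym (expect-1 (d ⊗ product ds)) ⟩
    expect (d ⊗ product ds) (λ _ → 1ℚ)               ≡⟨ expect-⊗ d (product ds) (λ _ → 1ℚ) ⟩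
    expect d (λ _ → expect (product ds) (λ _ → 1ℚ))  ≡⟨ expect-cong d (λ _ → trans (expect-1 (product ds))
                                                                                  (mass-product ds masses≡1)) ⟩
    expect d (λ _ → 1ℚ)                              ≡⟨ expect-1 d ⟩
    mass d                                           ≡⟨ mass≡1 ⟩
    1ℚ                                               ∎
    where open ≡-Reasoning

  expect-product-sum : ∀ ds → All (λ d → mass d ≡ 1ℚ) ds → (f : A → ℚ) →
                       expect (product ds) (λ as → sumℚ (map f as)) ≡ sumℚ (map (λ d → expect d f) ds)
  expect-product-sum []       []                  f = trans (ℚ.+-identityʳ _) (ℚ.*-zeroʳ 1ℚ)
  expect-product-sum (d ∷ ds) (mass≡1 ∷ masses≡1) f = begin
    expect (d ⊗ product ds) (λ as → sumℚ (map f as))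
      ≡⟨ expect-⊗ d (product ds) _ ⟩
    expect d (λ a → expect (product ds) (λ as → f a ℚ.+ sumℚ (map f as)))
      ≡⟨ expect-cong d (λ a → expect-+ (product ds) (λ _ → f a) _) ⟩
    expect d (λ a → expect (product ds) (λ _ → f a) ℚ.+ E)
      ≡⟨ expect-cong d (λ a → cong (ℚ._+ E) (mass≡1⇒expect-const (product ds) (mass-product ds masses≡1) (f a))) ⟩
    expect d (λ a → f a ℚ.+ E)
      ≡⟨ expect-+ d f (λ _ → E) ⟩
    expect d f ℚ.+ expect d (λ _ → E)
      ≡⟨ cong (ℚ._+_ (expect d f)) (mass≡1⇒expect-const d mass≡1 E) ⟩
    expect d f ℚ.+ E
      ≡⟨ cong (ℚ._+_ (expect d f)) (expect-product-sum ds masses≡1 f) ⟩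
    expect d f ℚ.+ sumℚ (map (λ d → expect d f) ds) ∎
    where
    open ≡-Reasoning
    E = expect (product ds) (λ as → sumℚ (map f as))

module _ {t : ℕ} where

  -- width I = |I| − 1; the halving bounds are multiplicative in the width, not in the size.
  width : Interval t → ℕ
  width I = hi I ∸ lo I

  length-elements : ∀ (I : Interval t) → length (elements I) ≡ size I
  length-elements I = trans (List.length-map (lo I +_) (upTo (size I))) (List.length-upTo (size I))

  record _⊆ᴵ_ (P I : Interval t) : Set where
    constructor mk⊆ᴵ
    field
      lo≤lo : lo I ≤ lo P
      hi≤hi : hi P ≤ hi I

  ⊆ᴵ-refl : ∀ I → I ⊆ᴵ I
  ⊆ᴵ-refl I = mk⊆ᴵ ℕ.≤-refl ℕ.≤-refl

  ⊆ᴵ-trans : ∀ {P Q I} → P ⊆ᴵ Q → Q ⊆ᴵ I → P ⊆ᴵ I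
  ⊆ᴵ-trans (mk⊆ᴵ l h) (mk⊆ᴵ l′ h′) = mk⊆ᴵ (ℕ.≤-trans l′ l) (ℕ.≤-trans h h′)

  ⊆ᴵ-∈ᴵ : ∀ {x P I} → P ⊆ᴵ I → x ∈ᴵ P → x ∈ᴵ I
  ⊆ᴵ-∈ᴵ (mk⊆ᴵ l h) (lo≤x , x≤hi) = ℕ.≤-trans l lo≤x , ℕ.≤-trans x≤hi h

  Disjoint-⊆ᴵ : ∀ {P Q I J} → P ⊆ᴵ I → Q ⊆ᴵ J → Disjoint I J → Disjoint P Q
  Disjoint-⊆ᴵ P⊆I Q⊆J I#J x (x∈P , x∈Q) = I#J x (⊆ᴵ-∈ᴵ P⊆I x∈P , ⊆ᴵ-∈ᴵ Q⊆J x∈Q)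

  AllPairs-Disjoint-⊆ᴵ : ∀ {Js Is} → Pointwise _⊆ᴵ_ Js Is → AllPairs Disjoint Is → AllPairs Disjoint Js
  AllPairs-Disjoint-⊆ᴵ []                            []               = []
  AllPairs-Disjoint-⊆ᴵ {P ∷ _} {I ∷ _} (P⊆I ∷ Js⊆Is) (I#Is ∷ Is-disj) =
    shrink Js⊆Is I#Is ∷ AllPairs-Disjoint-⊆ᴵ Js⊆Is Is-disj
    where
    shrink : ∀ {Qs Js} → Pointwise _⊆ᴵ_ Qs Js → All (Disjoint I) Js → All (Disjoint P) Qs
    shrink []            []           = []
    shrink (Q⊆J ∷ Qs⊆Js) (I#J ∷ I#Js) = Disjoint-⊆ᴵ P⊆I Q⊆J I#J ∷ shrink Qs⊆Js I#Js

  module Split (I : Interval t) {a b : ℕ} (width≡ : width I ≡ a + suc b) where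

    hi≡ : hi I ≡ lo I + suc a + b
    hi≡ = begin
      hi I                ≡⟨ sym (ℕ.m+[n∸m]≡n (lo≤hi I)) ⟩
      lo I + width I      ≡⟨ cong (lo I +_) (trans width≡ (ℕ.+-suc a b)) ⟩
      lo I + suc (a + b)  ≡⟨ sym (ℕ.+-assoc (lo I) (suc a) b) ⟩
      lo I + suc a + b    ∎
      where open ≡-Reasoning

    lo+1+a≤hi : lo I + suc a ≤ hi I
    lo+1+a≤hi = subst (lo I + suc a ≤_) (sym hi≡) (ℕ.m≤m+n (lo I + suc a) b)

    lo+a≤hi : lo I + a ≤ hi I
    lo+a≤hi = ℕ.≤-trans (ℕ.+-monoʳ-≤ (lo I) (ℕ.n≤1+n a)) lo+1+a≤hi

    lower : Interval t
    lower = interval (lo I) (lo I + a) (1≤lo I) (ℕ.m≤m+n (lo I) a) (ℕ.≤-trans lo+a≤hi (hi≤t I))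

    upper : Interval t
    upper = interval (lo I + suc a) (hi I) (ℕ.≤-trans (1≤lo I) (ℕ.m≤m+n (lo I) (suc a))) lo+1+a≤hi (hi≤t I)

    width-lower : width lower ≡ a
    width-lower = ℕ.m+n∸m≡n (lo I) a

    width-upper : width upper ≡ b
    width-upper = trans (cong (_∸ (lo I + suc a)) hi≡) (ℕ.m+n∸m≡n (lo I + suc a) b)

    lower-⊆ᴵ : lower ⊆ᴵ I
    lower-⊆ᴵ = mk⊆ᴵ ℕ.≤-refl lo+a≤hi

    upper-⊆ᴵ : upper ⊆ᴵ I
    upper-⊆ᴵ = mk⊆ᴵ (ℕ.m≤m+n (lo I) (suc a)) ℕ.≤-refl

    elements-lower++upper : elements lower ++ elements upper ≡ elements I
    elements-lower++upper = begin
      elements lower ++ elements upper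
        ≡⟨ cong₂ (λ m n → map (lo I +_) (upTo (suc m)) ++ map ((lo I + suc a) +_) (upTo (suc n))) width-lower width-upper ⟩
      map (lo I +_) (upTo (suc a)) ++ map ((lo I + suc a) +_) (upTo (suc b))
        ≡⟨ sym (map-+-upTo-+ (lo I) (suc a) (suc b)) ⟩
      map (lo I +_) (upTo (suc a + suc b))
        ≡⟨ cong (λ w → map (lo I +_) (upTo (suc w))) (sym width≡) ⟩
      elements I ∎
      where open ≡-Reasoning

  record Partition (c : ℕ) (I : Interval t) (Ps : List (Interval t)) : Set where
    field
      covers : concatMap elements Ps ≡ elements I
      inside : All (_⊆ᴵ I) Ps
      narrow : All (λ P → c * width P ≤ width I) Ps
      few    : length Ps ≤ c

  Partition-concatMap : ∀ {a b I Qs} {f : Interval t → List (Interval t)} →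
                        Partition a I Qs → (∀ Q → Partition b Q (f Q)) → Partition (a * b) I (concatMap f Qs)
  Partition-concatMap {a} {b} {I} {Qs} {f} outer inner = record
    { covers = begin
        concatMap elements (concatMap f Qs)    ≡⟨ concatMap-concatMap elements f Qs ⟩
        concatMap (concatMap elements ∘ f) Qs  ≡⟨ List.concatMap-cong (covers ∘ inner) Qs ⟩
        concatMap elements Qs                  ≡⟨ covers outer ⟩
        elements I                             ∎
    ; inside = All.concat⁺ (All.map⁺ (All.map (λ {Q} Q⊆I → All.map (λ P⊆Q → ⊆ᴵ-trans P⊆Q Q⊆I) (inside (inner Q)))
                                              (inside outer)))
    ; narrow = All.concat⁺ (All.map⁺ (All.map (λ {Q} aQ≤I → All.map (λ {P} bP≤Q → narrower {P} {Q} bP≤Q aQ≤I) (narrow (inner Q)))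
                                              (narrow outer)))
    ; few    = ℕ.≤-trans (length-concatMap-≤ (few ∘ inner) Qs) (ℕ.*-monoˡ-≤ b (few outer))
    }
    where
    open Partition
    open ≡-Reasoning
    narrower : ∀ {P Q} → b * width P ≤ width Q → a * width Q ≤ width I → a * b * width P ≤ width I
    narrower {P} bP≤Q aQ≤I = ℕ.≤-trans (ℕ.≤-reflexive (ℕ.*-assoc a b (width P))) (ℕ.≤-trans (ℕ.*-monoʳ-≤ a bP≤Q) aQ≤I)

  bisect : (I : Interval t) (w : ℕ) → width I ≡ w → List (Interval t)
  bisect I zero    _      = [ I ]
  bisect I (suc e) width≡ = lower ∷ upper ∷ []
    where open Split I (trans width≡ (1+n≡⌊n/2⌋+1+⌈n/2⌉ e))

  bisect-Partition : ∀ I w (width≡ : width I ≡ w) → Partition 2 I (bisect I w width≡)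
  bisect-Partition I zero width≡ = record
    { covers = List.++-identityʳ (elements I)
    ; inside = ⊆ᴵ-refl I ∷ []
    ; narrow = subst (λ w → 2 * w ≤ w) (sym width≡) z≤n ∷ []
    ; few    = s≤s z≤n
    }
  bisect-Partition I (suc e) width≡ = record
    { covers = trans (cong (elements lower ++_) (List.++-identityʳ (elements upper))) elements-lower++upper
    ; inside = lower-⊆ᴵ ∷ upper-⊆ᴵ ∷ []
    ; narrow = subst₂ (λ w w′ → 2 * w ≤ w′) (sym width-lower) (sym width≡) (ℕ.m≤n⇒m≤1+n (2*⌊n/2⌋≤n e))
             ∷ subst₂ (λ w w′ → 2 * w ≤ w′) (sym width-upper) (sym width≡) (2*⌊n/2⌋≤n (suc e))
             ∷ []
    ; few    = ℕ.≤-refl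
    }
    where open Split I (trans width≡ (1+n≡⌊n/2⌋+1+⌈n/2⌉ e))

  halve : Interval t → List (Interval t)
  halve I = bisect I (width I) refl

  pieces : Interval t → List (Interval t)
  pieces I = concatMap halve (halve I)

  pieces-Partition : ∀ I → Partition 4 I (pieces I)
  pieces-Partition I = Partition-concatMap (bisect-Partition I (width I) refl) (λ Q → bisect-Partition Q (width Q) refl)

  _∈ᴵ?_ : ∀ x (I : Interval t) → Dec (x ∈ᴵ I)
  x ∈ᴵ? I = (lo I ≤? x) ×-dec (x ≤? hi I)

  𝟙[_∈_] : ℕ → Interval t → ℕ
  𝟙[ x ∈ I ] = if does (x ∈ᴵ? I) then 1 else 0

  𝟙-∈ : ∀ {x} I → x ∈ᴵ I → 𝟙[ x ∈ I ] ≡ 1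
  𝟙-∈ {x} I x∈I = cong (if_then 1 else 0) (dec-true (x ∈ᴵ? I) x∈I)

  𝟙-∉ : ∀ {x} I → ¬ x ∈ᴵ I → 𝟙[ x ∈ I ] ≡ 0
  𝟙-∉ {x} I x∉I = cong (if_then 1 else 0) (dec-false (x ∈ᴵ? I) x∉I)

  sum-𝟙-∉ : ∀ {x Js} → All (λ J → ¬ x ∈ᴵ J) Js → sumℕ (map 𝟙[ x ∈_] Js) ≡ 0
  sum-𝟙-∉                []            = refl
  sum-𝟙-∉ {Js = J ∷ _} (x∉J ∷ x∉Js) = cong₂ _+_ (𝟙-∉ J x∉J) (sum-𝟙-∉ x∉Js)

  sum-𝟙≤1 : ∀ {Is} → AllPairs Disjoint Is → ∀ x → sumℕ (map 𝟙[ x ∈_] Is) ≤ 1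
  sum-𝟙≤1                []               x = z≤n
  sum-𝟙≤1 {I ∷ Is} (I#Is ∷ Is-disj) x with x ∈ᴵ? I
  ... | yes x∈I = subst (λ n → n + _ ≤ 1) (sym (𝟙-∈ I x∈I))
                        (s≤s (ℕ.≤-reflexive (sum-𝟙-∉ (All.map (λ I#J x∈J → I#J x (x∈I , x∈J)) I#Is))))
  ... | no  x∉I = subst (λ n → n + _ ≤ 1) (sym (𝟙-∉ I x∉I)) (sum-𝟙≤1 Is-disj x)

  -- |I ∩ [1, n]|: x runs over 0, …, n − 1.
  hits : Interval t → ℕ → ℕ
  hits I n = sumℕ (map (λ x → 𝟙[ suc x ∈ I ]) (downFrom n))

  hits-mono : ∀ I {m n} → m ≤′ n → hits I m ≤ hits I n
  hits-mono I ≤′-refl        = ℕ.≤-refl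
  hits-mono I (≤′-step m≤′n) = ℕ.≤-trans (hits-mono I m≤′n) (ℕ.m≤n+m _ _)

  1+n∸lo≤hits : ∀ I n → n ≤ hi I → suc n ∸ lo I ≤ hits I n
  1+n∸lo≤hits I zero    _     = ℕ.≤-trans (ℕ.≤-reflexive (ℕ.m≤n⇒m∸n≡0 (1≤lo I))) z≤n
  1+n∸lo≤hits I (suc n) 1+n≤hi with lo I ≤? suc n
  ... | yes lo≤1+n = begin
    suc (suc n) ∸ lo I         ≡⟨ ℕ.+-∸-assoc 1 lo≤1+n ⟩
    suc (suc n ∸ lo I)         ≤⟨ s≤s (1+n∸lo≤hits I n (ℕ.≤-trans (ℕ.n≤1+n n) 1+n≤hi)) ⟩
    1 + hits I n               ≡⟨ cong (_+ hits I n) (sym (𝟙-∈ I (lo≤1+n , 1+n≤hi))) ⟩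
    𝟙[ suc n ∈ I ] + hits I n  ∎
    where open ℕ.≤-Reasoning
  ... | no  lo≰1+n = ℕ.≤-trans (ℕ.≤-reflexive (ℕ.m≤n⇒m∸n≡0 (ℕ.≰⇒> lo≰1+n))) z≤n

  size≤hits : ∀ I → size I ≤ hits I t
  size≤hits I = begin
    size I             ≡⟨ sym (ℕ.+-∸-assoc 1 (lo≤hi I)) ⟩
    suc (hi I) ∸ lo I  ≤⟨ 1+n∸lo≤hits I (hi I) ℕ.≤-refl ⟩
    hits I (hi I)      ≤⟨ hits-mono I (ℕ.≤⇒≤′ (hi≤t I)) ⟩
    hits I t           ∎
    where open ℕ.≤-Reasoning

  sum-size≤t : ∀ {Is} → AllPairs Disjoint Is → sumℕ (map size Is) ≤ t
  sum-size≤t {Is} Is-disj = begin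
    sumℕ (map size Is)                                          ≤⟨ sumℕ-map-mono-≤ size≤hits Is ⟩
    sumℕ (map (λ I → hits I t) Is)                              ≡⟨ ℕSum.sum-map-comm (λ I x → 𝟙[ suc x ∈ I ]) Is (downFrom t) ⟩
    sumℕ (map (λ x → sumℕ (map 𝟙[ suc x ∈_] Is)) (downFrom t))  ≤⟨ sumℕ-map-≤-length (λ x → sum-𝟙≤1 Is-disj (suc x)) (downFrom t) ⟩
    length (downFrom t)                                         ≡⟨ List.length-downFrom t ⟩
    t                                                           ∎
    where open ℕ.≤-Reasoning

  sum-size : ∀ Is → sumℕ (map size Is) ≡ length Is + sumℕ (map width Is)
  sum-size []       = refl
  sum-size (I ∷ Is) = cong suc (trans (cong (width I +_) (sum-size Is)) (ℕ+.x∙yz≈y∙xz (width I) (length Is) _))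

  sum-width-Pointwise : ∀ {c Js Is} → Pointwise (λ P I → c * width P ≤ width I) Js Is →
                        c * sumℕ (map width Js) ≤ sumℕ (map width Is)
  sum-width-Pointwise {c}          []            = ℕ.≤-reflexive (ℕ.*-zeroʳ c)
  sum-width-Pointwise {c} {P ∷ Js} (cP≤I ∷ rest) =
    ℕ.≤-trans (ℕ.≤-reflexive (ℕ.*-distribˡ-+ c (width P) _)) (ℕ.+-mono-≤ cP≤I (sum-width-Pointwise {c} rest))

  uniform : Interval t → Weighted ℕ
  uniform I = map (λ x → (invSize I , x)) (elements I)

  Sets : List (Interval t) → Weighted (List ℕ)
  Sets Is = product (map uniform Is)

  expect-uniform : ∀ I h → expect (uniform I) h ≡ sumℚ (map (λ x → invSize I ℚ.* h x) (elements I))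
  expect-uniform I h = ℚSum.sum-map-∘ (λ e → proj₁ e ℚ.* h (proj₂ e)) (λ x → (invSize I , x)) (elements I)

  mass-uniform : ∀ I → mass (uniform I) ≡ 1ℚ
  mass-uniform I = begin
    sumℚ (map proj₁ (uniform I))               ≡⟨ ℚSum.sum-map-∘ proj₁ (λ x → (invSize I , x)) (elements I) ⟩
    sumℚ (map (λ _ → invSize I) (elements I))  ≡⟨ sumℚ-map-const (invSize I) (elements I) ⟩
    fromℕ (length (elements I)) ℚ.* invSize I  ≡⟨ cong (λ n → fromℕ n ℚ.* invSize I) (length-elements I) ⟩
    fromℕ (size I) ℚ.* invSize I               ≡⟨ n*1/n≡1 (width I) ⟩
    1ℚ                                         ∎
    where open ≡-Reasoning

  expect-Sets : ∀ Is g → expect (Sets Is) g ≡ sumℚ (map g (choices Is)) ℚ.* prodℚ (map invSize Is)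
  expect-Sets []       g = solve 1 (λ x → con 1ℚ :* x :+ con 0ℚ := (x :+ con 0ℚ) :* con 1ℚ) refl (g [])
    where open +-*-Solver
  expect-Sets (I ∷ Is) g = begin
    expect (uniform I ⊗ Sets Is) g
      ≡⟨ expect-⊗ (uniform I) (Sets Is) g ⟩
    expect (uniform I) (λ x → expect (Sets Is) (λ c → g (x ∷ c)))
      ≡⟨ expect-cong (uniform I) (λ x → expect-Sets Is (λ c → g (x ∷ c))) ⟩
    expect (uniform I) (λ x → S x ℚ.* W)
      ≡⟨ expect-uniform I (λ x → S x ℚ.* W) ⟩
    sumℚ (map (λ x → invSize I ℚ.* (S x ℚ.* W)) (elements I))
      ≡⟨ ℚSum.sum-map-cong (λ x → ℚ*.x∙yz≈zx∙y (invSize I) (S x) W) (elements I) ⟩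
    sumℚ (map (λ x → (W ℚ.* invSize I) ℚ.* S x) (elements I))
      ≡⟨ ℚSum.sum-map-*ˡ (W ℚ.* invSize I) S (elements I) ⟩
    (W ℚ.* invSize I) ℚ.* sumℚ (map S (elements I))
      ≡⟨ ℚ*.xy∙z≈z∙yx W (invSize I) _ ⟩
    sumℚ (map S (elements I)) ℚ.* (invSize I ℚ.* W)
      ≡⟨ cong (ℚ._* (invSize I ℚ.* W)) (sym sum-choices) ⟩
    sumℚ (map g (choices (I ∷ Is))) ℚ.* (invSize I ℚ.* W) ∎
    where
    open ≡-Reasoning
    W = prodℚ (map invSize Is)
    S : ℕ → ℚ
    S x = sumℚ (map (λ c → g (x ∷ c)) (choices Is))
    sum-choices : sumℚ (map g (choices (I ∷ Is))) ≡ sumℚ (map S (elements I))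
    sum-choices = trans (ℚSum.sum-map-concatMap g (λ x → map (x ∷_) (choices Is)) (elements I))
                        (ℚSum.sum-map-cong (λ x → ℚSum.sum-map-∘ g (x ∷_) (choices Is)) (elements I))

  sizeWeight : Interval t → Interval t → ℚ
  sizeWeight I P = ℤ.+ size P ℚ./ size I

  sizeBiased : Interval t → List (Interval t) → Weighted (Interval t)
  sizeBiased I Ps = map (λ P → (sizeWeight I P , P)) Ps

  sizeWeight-*-invSize : ∀ I P → sizeWeight I P ℚ.* invSize P ≡ invSize I
  sizeWeight-*-invSize I P = begin
    sizeWeight I P ℚ.* invSize P                  ≡⟨ cong (ℚ._* invSize P) (m/n≡m*1/n (size P) (width I)) ⟩
    (fromℕ (size P) ℚ.* invSize I) ℚ.* invSize P  ≡⟨ ℚ*.xy∙z≈y∙xz (fromℕ (size P)) (invSize I) (invSize P) ⟩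
    invSize I ℚ.* (fromℕ (size P) ℚ.* invSize P)  ≡⟨ cong (invSize I ℚ.*_) (n*1/n≡1 (width P)) ⟩
    invSize I ℚ.* 1ℚ                              ≡⟨ ℚ.*-identityʳ (invSize I) ⟩
    invSize I                                     ∎
    where open ≡-Reasoning

  expect-sizeBiased : ∀ I Ps f → expect (sizeBiased I Ps) f ≡ sumℚ (map (λ P → sizeWeight I P ℚ.* f P) Ps)
  expect-sizeBiased I Ps f = ℚSum.sum-map-∘ (λ e → proj₁ e ℚ.* f (proj₂ e)) (λ P → (sizeWeight I P , P)) Ps

  expect-sizeBiased-invSize : ∀ I Ps → expect (sizeBiased I Ps) invSize ≡ fromℕ (length Ps) ℚ.* invSize I
  expect-sizeBiased-invSize I Ps = begin
    expect (sizeBiased I Ps) invSize                    ≡⟨ expect-sizeBiased I Ps invSize ⟩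
    sumℚ (map (λ P → sizeWeight I P ℚ.* invSize P) Ps)  ≡⟨ ℚSum.sum-map-cong (sizeWeight-*-invSize I) Ps ⟩
    sumℚ (map (λ _ → invSize I) Ps)                     ≡⟨ sumℚ-map-const (invSize I) Ps ⟩
    fromℕ (length Ps) ℚ.* invSize I                     ∎
    where open ≡-Reasoning

  module _ (I : Interval t) (Ps : List (Interval t)) (covers : concatMap elements Ps ≡ elements I) where

    expect-sizeBiased-uniform : ∀ h → expect (sizeBiased I Ps) (λ P → expect (uniform P) h) ≡ expect (uniform I) h
    expect-sizeBiased-uniform h = begin
      expect (sizeBiased I Ps) (λ P → expect (uniform P) h)
        ≡⟨ expect-sizeBiased I Ps (λ P → expect (uniform P) h) ⟩
      sumℚ (map (λ P → sizeWeight I P ℚ.* expect (uniform P) h) Ps)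
        ≡⟨ ℚSum.sum-map-cong (λ P → trans (cong (sizeWeight I P ℚ.*_) (expect-uniform P h))
                                          (sym (ℚSum.sum-map-*ˡ (sizeWeight I P) (λ x → invSize P ℚ.* h x) (elements P)))) Ps ⟩
      sumℚ (map (λ P → sumℚ (map (λ x → sizeWeight I P ℚ.* (invSize P ℚ.* h x)) (elements P))) Ps)
        ≡⟨ ℚSum.sum-map-cong (λ P → ℚSum.sum-map-cong (λ x → trans (sym (ℚ.*-assoc (sizeWeight I P) (invSize P) (h x)))
                                                                     (cong (ℚ._* h x) (sizeWeight-*-invSize I P)))
                                                      (elements P)) Ps ⟩
      sumℚ (map (λ P → sumℚ (map (λ x → invSize I ℚ.* h x) (elements P))) Ps)
        ≡⟨ sym (ℚSum.sum-map-concatMap (λ x → invSize I ℚ.* h x) elements Ps) ⟩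
      sumℚ (map (λ x → invSize I ℚ.* h x) (concatMap elements Ps))
        ≡⟨ cong (λ xs → sumℚ (map (λ x → invSize I ℚ.* h x) xs)) covers ⟩
      sumℚ (map (λ x → invSize I ℚ.* h x) (elements I))
        ≡⟨ sym (expect-uniform I h) ⟩
      expect (uniform I) h ∎
      where open ≡-Reasoning

    mass-sizeBiased : mass (sizeBiased I Ps) ≡ 1ℚ
    mass-sizeBiased = begin
      mass (sizeBiased I Ps)                                          ≡⟨ sym (expect-1 (sizeBiased I Ps)) ⟩
      expect (sizeBiased I Ps) (λ _ → 1ℚ)                             ≡⟨ expect-cong (sizeBiased I Ps) (λ P →
                                                                           sym (trans (expect-1 (uniform P)) (mass-uniform P))) ⟩
      expect (sizeBiased I Ps) (λ P → expect (uniform P) (λ _ → 1ℚ))  ≡⟨ expect-sizeBiased-uniform (λ _ → 1ℚ) ⟩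
      expect (uniform I) (λ _ → 1ℚ)                                   ≡⟨ expect-1 (uniform I) ⟩
      mass (uniform I)                                                ≡⟨ mass-uniform I ⟩
      1ℚ                                                              ∎
      where open ≡-Reasoning

  Piece : Interval t → Interval t → Set
  Piece P I = P ⊆ᴵ I × 4 * width P ≤ width I

  pieceDist : Interval t → Weighted (Interval t)
  pieceDist I = sizeBiased I (pieces I)

  pieceDist-supported : ∀ I → Supported (λ P → Piece P I) (pieceDist I)
  pieceDist-supported I = All.map⁺ (All.zipWith (λ {P} piece → 0≤m/n (size P) (width I) , piece)
                                                (Partition.inside (pieces-Partition I) , Partition.narrow (pieces-Partition I)))

  mass-pieceDist : ∀ I → mass (pieceDist I) ≡ 1ℚ
  mass-pieceDist I = mass-sizeBiased I (pieces I) (Partition.covers (pieces-Partition I))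

  refinement : List (Interval t) → Weighted (List (Interval t))
  refinement Is = product (map pieceDist Is)

  refinement-supported : ∀ Is → Supported (λ Js → Pointwise Piece Js Is) (refinement Is)
  refinement-supported Is = product-supported Piece pieceDist Is (All.universal pieceDist-supported Is)

  mass-refinement : ∀ Is → mass (refinement Is) ≡ 1ℚ
  mass-refinement Is = mass-product (map pieceDist Is) (All.map⁺ (All.universal mass-pieceDist Is))

  expect-refinement-Sets : ∀ Is g → expect (refinement Is) (λ Js → expect (Sets Js) g) ≡ expect (Sets Is) g
  expect-refinement-Sets []       g = trans (ℚ.+-identityʳ _) (ℚ.*-identityˡ _)
  expect-refinement-Sets (I ∷ Is) g = begin
    expect (pieceDist I ⊗ refinement Is) (λ Js → expect (Sets Js) g)
      ≡⟨ expect-⊗ (pieceDist I) (refinement Is) _ ⟩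
    expect (pieceDist I) (λ P → expect (refinement Is) (λ Js → expect (uniform P ⊗ Sets Js) g))
      ≡⟨ expect-cong (pieceDist I) (λ P → expect-cong (refinement Is) (λ Js → expect-⊗ (uniform P) (Sets Js) g)) ⟩
    expect (pieceDist I) (λ P → expect (refinement Is) (λ Js → expect (uniform P) (λ x → expect (Sets Js) (g ∘ (x ∷_)))))
      ≡⟨ expect-cong (pieceDist I) (λ P → expect-comm (refinement Is) (uniform P) _) ⟩
    expect (pieceDist I) (λ P → expect (uniform P) (λ x → expect (refinement Is) (λ Js → expect (Sets Js) (g ∘ (x ∷_)))))
      ≡⟨ expect-cong (pieceDist I) (λ P → expect-cong (uniform P) (λ x → expect-refinement-Sets Is (g ∘ (x ∷_)))) ⟩
    expect (pieceDist I) (λ P → expect (uniform P) (λ x → expect (Sets Is) (g ∘ (x ∷_))))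
      ≡⟨ expect-sizeBiased-uniform I (pieces I) (Partition.covers (pieces-Partition I)) _ ⟩
    expect (uniform I) (λ x → expect (Sets Is) (g ∘ (x ∷_)))
      ≡⟨ sym (expect-⊗ (uniform I) (Sets Is) g) ⟩
    expect (uniform I ⊗ Sets Is) g ∎
    where open ≡-Reasoning

  expect-refinement-val : ∀ Is → expect (refinement Is) (λ Js → sumℚ (map invSize Js))
                                 ≡ sumℚ (map (λ I → fromℕ (length (pieces I)) ℚ.* invSize I) Is)
  expect-refinement-val Is = begin
    expect (refinement Is) (λ Js → sumℚ (map invSize Js))
      ≡⟨ expect-product-sum (map pieceDist Is) (All.map⁺ (All.universal mass-pieceDist Is)) invSize ⟩
    sumℚ (map (λ d → expect d invSize) (map pieceDist Is))
      ≡⟨ ℚSum.sum-map-∘ (λ d → expect d invSize) pieceDist Is ⟩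
    sumℚ (map (λ I → expect (pieceDist I) invSize) Is)
      ≡⟨ ℚSum.sum-map-cong (λ I → expect-sizeBiased-invSize I (pieces I)) Is ⟩
    sumℚ (map (λ I → fromℕ (length (pieces I)) ℚ.* invSize I) Is) ∎
    where open ≡-Reasoning

  refinement-Valid : ∀ {Js Is} → Pointwise Piece Js Is → AllPairs Disjoint Is → 6 * length Is ≤ t →
                     2 * sumℕ (map size Js) ≤ t
  refinement-Valid {Js} {Is} Js-pieces Is-disj 6k≤t = ℕ.*-cancelˡ-≤ 4 (begin
    4 * (2 * sumℕ (map size Js))  ≡⟨ cong (λ s → 4 * (2 * s)) (trans (sum-size Js) (cong (_+ W) (Pointwise-length Js-pieces))) ⟩
    4 * (2 * (k + W))             ≡⟨ solve 2 (λ k W → con 4 :* (con 2 :* (k :+ W)) := con 2 :* (con 4 :* W) :+ con 8 :* k) refl k W ⟩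
    2 * (4 * W) + 8 * k           ≤⟨ ℕ.+-monoˡ-≤ (8 * k) (ℕ.*-monoʳ-≤ 2 (sum-width-Pointwise {4} (Pointwise.map proj₂ Js-pieces))) ⟩
    2 * V + 8 * k                 ≡⟨ solve 2 (λ k V → con 2 :* V :+ con 8 :* k := con 2 :* (k :+ V) :+ con 6 :* k) refl k V ⟩
    2 * (k + V) + 6 * k           ≤⟨ ℕ.+-mono-≤ (ℕ.*-monoʳ-≤ 2 (subst (_≤ t) (sum-size Is) (sum-size≤t Is-disj))) 6k≤t ⟩
    2 * t + t                     ≡⟨ solve 1 (λ t → con 2 :* t :+ t := con 3 :* t) refl t ⟩
    3 * t                         ≤⟨ ℕ.*-monoˡ-≤ t (ℕ.n≤1+n 3) ⟩
    4 * t                         ∎)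
    where
    open ℕ.≤-Reasoning
    open ℕSolver
    k = length Is
    W = sumℕ (map width Js)
    V = sumℕ (map width Is)

𝟙[_≡_] : ∀ {t} → List ℕ → Subset t → ℚ
𝟙[ c ≡ S ] = if does (≡-dec Bool._≟_ (toSubset c) S) then 1ℚ else 0ℚ

setsProb≡expect-Sets : ∀ {t k} (F : IntervalSystem t k) S → setsProb F S ≡ expect (Sets (intervals F)) 𝟙[_≡ S ]
setsProb≡expect-Sets F S = trans
  (cong (ℚ._* prodℚ (map invSize (intervals F))) (length-filter (λ c → ≡-dec Bool._≟_ (toSubset c) S) (choices (intervals F))))
  (sym (expect-Sets (intervals F) 𝟙[_≡ S ]))

module _ {t k : ℕ} (F : IntervalSystem t k) where

  private
    Is = intervals F

  refinedEntry : ∀ {e} → 0ℚ ℚ.≤ proj₁ e × Pointwise Piece (proj₂ e) Is → ℚ × IntervalSystem t k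
  refinedEntry {e} (_ , Js-pieces) =
    proj₁ e , system (proj₂ e) (trans (Pointwise-length Js-pieces) (card F))
                               (AllPairs-Disjoint-⊆ᴵ (Pointwise.map proj₁ Js-pieces) (disjoint F))

  refinedEntries : List (ℚ × IntervalSystem t k)
  refinedEntries = All.reduce refinedEntry (refinement-supported Is)

  expect-refinedEntries : ∀ (f : List (Interval t) → ℚ) →
                          sumℚ (map (λ p → proj₁ p ℚ.* f (intervals (proj₂ p))) refinedEntries) ≡ expect (refinement Is) f
  expect-refinedEntries f = cong sumℚ (map-reduce refinedEntry _ _ (λ _ → refl) (refinement-supported Is))

  randomRefinement : RandSystem t k
  randomRefinement = randSystem refinedEntries
    (All-reduce refinedEntry proj₁ (refinement-supported Is))
    (trans (cong sumℚ (map-reduce refinedEntry proj₁ proj₁ (λ _ → refl) (refinement-supported Is))) (mass-refinement Is))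

  randSetsProb-randomRefinement : ∀ S → randSetsProb randomRefinement S ≡ setsProb F S
  randSetsProb-randomRefinement S = begin
    randSetsProb randomRefinement S
      ≡⟨ ℚSum.sum-map-cong (λ p → cong (proj₁ p ℚ.*_) (setsProb≡expect-Sets (proj₂ p) S)) refinedEntries ⟩
    sumℚ (map (λ p → proj₁ p ℚ.* expect (Sets (intervals (proj₂ p))) 𝟙[_≡ S ]) refinedEntries)
      ≡⟨ expect-refinedEntries (λ Js → expect (Sets Js) 𝟙[_≡ S ]) ⟩
    expect (refinement Is) (λ Js → expect (Sets Js) 𝟙[_≡ S ])
      ≡⟨ expect-refinement-Sets Is 𝟙[_≡ S ] ⟩
    expect (Sets Is) 𝟙[_≡ S ]
      ≡⟨ sym (setsProb≡expect-Sets F S) ⟩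
    setsProb F S ∎
    where open ≡-Reasoning

  randVal-randomRefinement : randVal randomRefinement ℚ.≤ fromℕ 4 ℚ.* val F
  randVal-randomRefinement = begin
    randVal randomRefinement
      ≡⟨ expect-refinedEntries (λ Js → sumℚ (map invSize Js)) ⟩
    expect (refinement Is) (λ Js → sumℚ (map invSize Js))
      ≡⟨ expect-refinement-val Is ⟩
    sumℚ (map (λ I → fromℕ (length (pieces I)) ℚ.* invSize I) Is)
      ≤⟨ sumℚ-map-mono-≤ (λ I → ℚ.*-monoʳ-≤-nonNeg (invSize I) {{ℚ.nonNegative (0≤m/n 1 (width I))}}
                                                   (fromℕ-mono-≤ (Partition.few (pieces-Partition I)))) Is ⟩
    sumℚ (map (λ I → fromℕ 4 ℚ.* invSize I) Is)
      ≡⟨ ℚSum.sum-map-*ˡ (fromℕ 4) invSize Is ⟩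
    fromℕ 4 ℚ.* val F ∎
    where open ℚ.≤-Reasoning

  randomRefinement-Valid : 6 * k ≤ t → RandValid randomRefinement
  randomRefinement-Valid 6k≤t = All-reduce refinedEntry
    (λ (_ , Js-pieces) _ → refinement-Valid Js-pieces (disjoint F) (subst (λ n → 6 * n ≤ t) (sym (card F)) 6k≤t))
    (refinement-supported Is)

  val-nonNeg : 0ℚ ℚ.≤ val F
  val-nonNeg = subst (ℚ._≤ val F) (ℚSum.sum-map-0# Is) (sumℚ-map-mono-≤ (λ I → 0≤m/n 1 (width I)) Is)

open import Data.Integer using (+_)

lemma3p12 : (t k : ℕ) → 1 ≤ t → 1 ≤ k → 6 * k ≤ t → (F : IntervalSystem t k) →
    Σ (RandSystem t k) (λ 𝓕 →
      ((S : Subset t) → randSetsProb 𝓕 S ≡ setsProb F S)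
      × randVal 𝓕 ℚ.≤ ((+ 5) ℚ./ 1) ℚ.* val F
      × RandValid 𝓕)
lemma3p12 t k _ _ 6k≤t F =
  randomRefinement F ,
  randSetsProb-randomRefinement F ,
  ℚ.≤-trans (randVal-randomRefinement F)
            (ℚ.*-monoʳ-≤-nonNeg (val F) {{ℚ.nonNegative (val-nonNeg F)}} (fromℕ-mono-≤ (ℕ.n≤1+n 4))) ,
  randomRefinement-Valid F 6k≤t
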